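{- Let $F$ be a forest, and consider a play of the Sweller-start competition-independence game on $F$ in which Sweller follows the greedy strategy described in the context and Diminisher plays arbitrarily, and let $i \geq 1$ be such that Diminisher makes an $i$-th move. Suppose $v_i^D(w_i^D) = 1+l$ and $e_i^D(w_i^D) = l+p$. Then: (1) If $l=2$ and $p=0$, there is $\hat{w}_i^S \in V(F_{i-1}^D)$ such that either $v_i^S(\hat{w}_i^S)=2$, $e_i^S(\hat{w}_i^S)\geq 2$ and $k_i^S(\hat{w}_i^S)\geq 1$, or $v_i^S(\hat{w}_i^S)=3$, $e_i^S(\hat{w}_i^S)\geq 4$ and $k_i^S(\hat{w}_i^S)\geq 1$. (2) If $l=3$ and $p=0$, there is $\hat{w}_i^S \in V(F_{i-1}^D)$ such that $v_i^S(\hat{w}_i^S)=2$, $e_i^S(\hat{w}_i^S)\geq 3$ and $k_i^S(\hat{w}_i^S)\geq 1$. (3) If $l=3$ and $p=1$, there is $\hat{w}_i^S \in V(F_{i-1}^D)$ such that either $v_i^S(\hat{w}_i^S)=2$, $e_i^S(\hat{w}_i^S)\geq 3$ and $k_i^S(\hat{w}_i^S)\geq 1$, or $v_i^S(\hat{w}_i^S)=3$, $e_i^S(\hat{w}_i^S)\geq 5$ and $k_i^S(\hat{w}_i^S)\geq 1$. (4) If $l=2$ and $p=1$, or $3 \leq l = p \leq 4$, there is $\hat{w}_i^S \in V(F_{i-1}^D)$ such that $v_i^S(\hat{w}_i^S)=2$ and $e_i^S(\hat{w}_i^S)\geq 2$. (5) If $l=1$ and $p=0$, there is $\hat{w}_i^S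 \in V(F_{i-1}^D)$ such that $v_i^S(\hat{w}_i^S)=2$ and $e_i^S(\hat{w}_i^S)\geq 1$. (6) If $l=0$ and $p=0$, there is $\hat{w}_i^S \in V(F_{i-1}^D)$ such that either $v_i^S(\hat{w}_i^S)=2$ and $e_i^S(\hat{w}_i^S)\geq 1$, or $v_i^S(\hat{w}_i^S)=1$ and $k_i^S(\hat{w}_i^S)=-1$.
   Context: The game is rephrased as follows: starting from the forest $F$, players alternately pick a vertex $u$ of the current forest $H$ and replace $H$ by $H - N_H[u]$; Sweller moves first and the game ends when the forest is empty. For a graph $G$, $K(G)$ is its number of isolated vertices. Set $F_0^D = F$. For $i \geq 1$, Sweller's $i$-th move is a vertex $w_i^S$ of $F_{i-1}^D$ and $F_i^S = F_{i-1}^D - N[w_i^S]$; Diminisher's $i$-th move is a vertex $w_i^D$ of $F_i^S$ and $F_i^D = F_i^S - N[w_i^D]$. For $u \in V(F_{i-1}^D)$ define $v_i^S(u) = |N_{F_{i-1}^D}[u]|$, $e_i^S(u) = |E(F_{i-1}^D)| - |E(F_{i-1}^D - N[u])|$, $k_i^S(u) = K(F_{i-1}^D - N[u]) - K(F_{i-1}^D)$, and $m_i^S(u) = (1-\beta)k_i^S(u) + v_i^S(u) - \alpha e_i^S(u)$ with $\alpha = 3/8$, $\beta = 13/8$. For $u \in V(F_i^S)$: $v_i^D(u) = |N_{F_i^S}[u]|$ and $e_i^D(u) = |E(F_i^S)| - |E(F_i^S - N[u])|$. The greedy strategy: at her $i$-th move Sweller picks any vertex $w_i^S$ of $F_{i-1}^D$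 minimizing $m_i^S$. -}

module Defs where

open import Data.Nat using (ℕ; zero; suc; _+_; _≤_)
open import Data.Bool using (Bool; true; false; _∧_; _∨_; not; if_then_else_)
open import Data.Fin using (Fin; _<?_) renaming (_≟_ to _≟ᶠ_)
open import Data.Fin.Subset using (Subset; _∈_; ∣_∣; _─_)
open import Data.List using (List; []; _∷_; length; _∷ʳ_; allFin)
open import Data.List.Relation.Unary.Unique.Propositional using (Unique)
open import Data.List.Relation.Unary.Linked using (Linked)
open import Data.Vec using (lookup; tabulate)
open import Data.Integer using (ℤ; +_) renaming (_-_ to _-ℤ_)
open import Data.Rational using (ℚ; _/_; 1ℚ; _*_; _-_) renaming (_+_ to _+ℚ_; _≤_ to _≤ℚ_)
open import Relation.Nullary using (¬_)
open import Relation.Nullary.Decidable using (⌊_⌋)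
open import Relation.Binary.PropositionalEquality using (_≡_)
open import Data.Product using (Σ; _×_)

record Graph (n : ℕ) : Set where
  field
    adj    : Fin n → Fin n → Bool
    adj-sym    : ∀ x y → adj x y ≡ adj y x
    adj-irrefl : ∀ x → adj x x ≡ false
open Graph public

record Cycle {n : ℕ} (G : Graph n) : Set where
  field
    first  : Fin n
    middle : List (Fin n)
    lastv  : Fin n
    middle-nonempty : 1 ≤ length middle
    distinct : Unique ((first ∷ middle) ∷ʳ lastv)
    path     : Linked (λ a b → adj G a b ≡ true) ((first ∷ middle) ∷ʳ lastv)
    closing  : adj G lastv first ≡ true

IsForest : {n : ℕ} → Graph n → Set
IsForest G = ¬ Cycle G

count : {A : Set} → (A → Bool) → List A → ℕ
count P []       = 0
count P (x ∷ xs) = if P x then suc (count P xs) else count P xs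

sumOver : {A : Set} → (A → ℕ) → List A → ℕ
sumOver f []       = 0
sumOver f (x ∷ xs) = f x + sumOver f xs

allTrue : {A : Set} → (A → Bool) → List A → Bool
allTrue P []       = true
allTrue P (x ∷ xs) = P x ∧ allTrue P xs

module _ {n : ℕ} (G : Graph n) where

  -- The current forest H is the subgraph of G induced by a vertex subset S.

  N[_,_] : Subset n → Fin n → Subset n
  N[ S , u ] = tabulate (λ x → lookup S x ∧ (⌊ x ≟ᶠ u ⌋ ∨ adj G u x))

  remove : Subset n → Fin n → Subset n
  remove S u = S ─ N[ S , u ]

  numEdges : Subset n → ℕ
  numEdges S = sumOver (λ x → count (λ y → ⌊ x <? y ⌋ ∧ (lookup S x ∧ (lookup S y ∧ adj G x y))) (allFin n)) (allFin n)

  numIsolated : Subset n → ℕ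
  numIsolated S = count (λ x → lookup S x ∧ allTrue (λ y → not (lookup S y ∧ adj G x y)) (allFin n)) (allFin n)

  vS : Subset n → Fin n → ℕ
  vS S u = ∣ N[ S , u ] ∣

  eS : Subset n → Fin n → ℤ
  eS S u = + numEdges S -ℤ + numEdges (remove S u)

  kS : Subset n → Fin n → ℤ
  kS S u = + numIsolated (remove S u) -ℤ + numIsolated S

  -- Diminisher's quantities (same formulas, on the forest F_i^S)
  vD : Subset n → Fin n → ℕ
  vD = vS

  eD : Subset n → Fin n → ℤ
  eD = eS

  α β : ℚ
  α = + 3 / 8
  β = + 13 / 8

  mS : Subset n → Fin n → ℚ
  mS S u = ((1ℚ - β) * (kS S u / 1)) +ℚ (((+ (vS S u)) / 1) - (α * (eS S u / 1)))

  Greedy : Subset n → Fin n → Set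
  Greedy S w = w ∈ S × (∀ u → u ∈ S → mS S w ≤ℚ mS S u)

  -- Reachable i S : after i full rounds of a play starting from F = G (all vertices),
  -- in which Sweller played greedily and Diminisher arbitrarily, F_i^D = G[S].
  data Reachable : ℕ → Subset n → Set where
    start : Reachable 0 (tabulate (λ _ → true))
    round : ∀ {i S} → Reachable i S →
            (wS : Fin n) → Greedy S wS →
            (wD : Fin n) → wD ∈ remove S wS →
            Reachable (suc i) (remove (remove S wS) wD)

module Submission where

-- Write S₁ = H − N[wS] for the forest Diminisher moves in and ys for the S₁-neighbours of his vertex
-- d, so l = |ys|. The S₁-edges his move deletes are the l spokes d–y (y ∈ ys) and p further edges,
-- each leaving a spoke end; so for p = 0 every spoke end is a leaf of S₁, and for p = 1 all but at
-- most one are. In H such a spoke end can only have further neighbours adjacent to wS; since H is a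
-- forest it has at most one (two would close a 4-cycle through wS), and at most one spoke end has
-- any (two would close a 4- or 6-cycle through d and wS). Playing at a spoke end a that is a leaf of
-- H has v = 2, deletes all l spokes and isolates any other spoke end that is a leaf of H; if a has
-- its extra neighbour y instead, the move has v = 3 and also deletes a–y and y–wS. Parts (4)–(6)
-- only need a leaf of H near d: a path through d, extended at one end while possible, ends in a leaf
-- whose neighbour has a second neighbour as soon as the path had three vertices.

open import Defs
open import Data.Bool using (Bool; true; false; _∧_; _∨_; not; if_then_else_)
open import Data.Bool.Properties using (∧-conicalˡ; ∧-conicalʳ; ∧-zeroʳ; ¬-not) renaming (_≟_ to _≟ᵇ_)
open import Data.Empty using (⊥; ⊥-elim)
open import Data.Fin as Fin using (Fin; _<?_) renaming (_≟_ to _≟ᶠ_)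
open import Data.Fin.Properties using (≤∧≢⇒<; any?)
open import Data.Fin.Subset using (Subset; _∈_; _∉_; ∣_∣; _─_)
open import Data.Fin.Subset.Properties using (x∈p∧x∉q⇒x∈p─q; p─q⊆p; _∈?_)
open import Data.Integer using (+_; -_; -[1+_]; +≤+) renaming (_-_ to _-ℤ_; _≤_ to _≤ℤ_)
open import Data.Integer.Properties using (m-n≡m⊖n; ⊖-≥; ⊖-<; drop‿+≤+)
open import Data.List as List using (List; []; _∷_; _++_; length; filter; allFin; cartesianProduct; map)
open import Data.List.Properties using (length-++; length-map; length-tabulate; ++-assoc)
open import Data.List.Membership.Propositional using () renaming (_∈_ to _∈ˡ_; _∉_ to _∉ˡ_)
open import Data.List.Membership.Propositional.Properties
  using (∈-∃++; ∈-++⁺ˡ; ∈-++⁺ʳ; ∈-++⁻; ∈-filter⁺; ∈-filter⁻; ∈-allFin; ∈-cartesianProduct⁺; ∈-map⁻)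
open import Data.List.Relation.Unary.All as All using (All; []; _∷_)
open import Data.List.Relation.Unary.All.Properties
  using (¬Any⇒All¬) renaming (++⁺ to All-++⁺; ++⁻ˡ to All-++⁻ˡ; map⁺ to All-map⁺)
open import Data.List.Relation.Unary.Any using (here; there)
open import Data.List.Relation.Unary.AllPairs using (AllPairs; []; _∷_)
open import Data.List.Relation.Unary.Linked using (Linked; []; [-]; _∷_)
open import Data.List.Relation.Unary.Unique.Propositional using (Unique)
open import Data.List.Relation.Unary.Unique.Propositional.Properties
  using (filter⁺; allFin⁺) renaming (++⁺ to Unique-++⁺; map⁺ to Unique-map⁺)
open import Data.Nat using (ℕ; zero; suc; _+_; _≤_; _<_; z≤n; s≤s)
open import Data.Nat.Properties
  using (≤-refl; ≤-trans; ≤-reflexive; ≤-antisym; +-suc; +-comm; +-identityʳ; m≤m+n; m+n∸m≡n; m<m+n; m<n+m;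
         n≤1+n; n≮n; ≮⇒≥; <⇒≱; suc-injective)
open import Data.Product using (Σ; ∃-syntax; _×_; _,_; proj₁; proj₂; uncurry)
open import Data.Sum using (_⊎_; inj₁; inj₂; [_,_])
open import Data.Vec using ([]; _∷_; here; there; lookup; tabulate)
open import Data.Vec.Properties using ([]=⇒lookup; lookup⇒[]=; lookup∘tabulate)
open import Function using (_∘_; _$_)
open import Relation.Nullary using (¬_; Dec; yes; no)
open import Relation.Nullary.Decidable using (⌊_⌋; _×-dec_; ¬?; decidable-stable)
open import Relation.Unary using (Decidable)
open import Relation.Binary.PropositionalEquality
  using (_≡_; _≢_; refl; sym; trans; cong; cong₂; subst; ≢-sym; module ≡-Reasoning)

∧-not-intro : ∀ {a b} → a ≡ true → b ≡ false → a ∧ not b ≡ true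
∧-not-intro refl refl = refl

true≢false : true ≢ false
true≢false ()

⌊⌋-true : ∀ {P : Set} (P? : Dec P) → P → ⌊ P? ⌋ ≡ true
⌊⌋-true (yes _) _ = refl
⌊⌋-true (no ¬p) p = ⊥-elim (¬p p)

∧-not-elim : ∀ a b → a ∧ not b ≡ true → a ≡ true × b ≡ false
∧-not-elim true false _ = refl , refl

+[m+n]-+m≡+n : ∀ m n → + (m + n) -ℤ + m ≡ + n
+[m+n]-+m≡+n m n = trans (m-n≡m⊖n (m + n) m) (trans (⊖-≥ (m≤m+n m n)) (cong +_ (m+n∸m≡n m n)))

+m-+[m+1]≡-1 : ∀ m → + m -ℤ + (m + 1) ≡ -[1+ 0 ]
+m-+[m+1]≡-1 m = trans (m-n≡m⊖n m (m + 1)) (trans (⊖-< (m<m+n m (s≤s z≤n))) (cong (-_ ∘ +_) (m+n∸m≡n m 1)))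

module _ {A : Set} where

  holds? : (P : A → Bool) → Decidable (λ x → P x ≡ true)
  holds? P x = P x ≟ᵇ true

  count≡length∘filter : ∀ (P : A → Bool) xs → count P xs ≡ length (filter (holds? P) xs)
  count≡length∘filter P [] = refl
  count≡length∘filter P (x ∷ xs) with P x
  ... | true  = cong suc (count≡length∘filter P xs)
  ... | false = count≡length∘filter P xs

  length-mono-⊆ : ∀ {xs ys : List A} → Unique xs → (∀ {x} → x ∈ˡ xs → x ∈ˡ ys) →
                  length xs ≤ length ys
  length-mono-⊆ {[]} _ _ = z≤n
  length-mono-⊆ {x ∷ xs} (x∉xs ∷ uxs) xs⊆ys with ∈-∃++ (xs⊆ys (here refl))
  ... | ys₁ , ys₂ , refl = ≤-trans (s≤s (length-mono-⊆ uxs xs⊆ys₁++ys₂)) (≤-reflexive (sym length-split))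
    where
      xs⊆ys₁++ys₂ : ∀ {y} → y ∈ˡ xs → y ∈ˡ ys₁ ++ ys₂
      xs⊆ys₁++ys₂ y∈xs with ∈-++⁻ ys₁ (xs⊆ys (there y∈xs))
      ... | inj₁ y∈ys₁          = ∈-++⁺ˡ y∈ys₁
      ... | inj₂ (here refl)    = ⊥-elim (All.lookup x∉xs y∈xs refl)
      ... | inj₂ (there y∈ys₂)  = ∈-++⁺ʳ ys₁ y∈ys₂
      length-split : length (ys₁ ++ x ∷ ys₂) ≡ suc (length (ys₁ ++ ys₂))
      length-split = trans (length-++ ys₁) (trans (+-suc _ _) (cong suc (sym (length-++ ys₁))))

  count-lower : ∀ (P : A → Bool) {L xs} → Unique L →
                (∀ {x} → x ∈ˡ L → x ∈ˡ xs × P x ≡ true) → length L ≤ count P xs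
  count-lower P {xs = xs} uL L⊆ =
    subst (_ ≤_) (sym (count≡length∘filter P xs))
          (length-mono-⊆ uL (uncurry (∈-filter⁺ (holds? P)) ∘ L⊆))

  count-upper : ∀ (P : A → Bool) {L xs} → Unique xs →
                (∀ {x} → x ∈ˡ xs → P x ≡ true → x ∈ˡ L) → count P xs ≤ length L
  count-upper P {xs = xs} uxs ⊆L =
    subst (_≤ _) (sym (count≡length∘filter P xs))
          (length-mono-⊆ (filter⁺ (holds? P) uxs) (uncurry ⊆L ∘ ∈-filter⁻ (holds? P)))

  count-split : ∀ (P Q : A → Bool) → (∀ {x} → P x ≡ true → Q x ≡ true) → ∀ xs →
                count Q xs ≡ count P xs + count (λ x → Q x ∧ not (P x)) xs
  count-split P Q P⇒Q [] = refl
  count-split P Q P⇒Q (x ∷ xs) with P x in Px | Q x in Qx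
  ... | true  | true  = cong suc (count-split P Q P⇒Q xs)
  ... | true  | false with () ← trans (sym (P⇒Q Px)) Qx
  ... | false | true  = trans (cong suc (count-split P Q P⇒Q xs)) (sym (+-suc _ _))
  ... | false | false = count-split P Q P⇒Q xs

count-tabulate : ∀ {A : Set} {m} (P : A → Bool) (g : Fin m → A) →
                 count P (List.tabulate g) ≡ count (P ∘ g) (allFin m)
count-tabulate {m = zero} P g = refl
count-tabulate {m = suc m} P g with P (g Fin.zero)
... | true  = cong suc (trans (count-tabulate P (g ∘ Fin.suc)) (sym (count-tabulate (P ∘ g) Fin.suc)))
... | false = trans (count-tabulate P (g ∘ Fin.suc)) (sym (count-tabulate (P ∘ g) Fin.suc))

allTrue⁺ : ∀ {A : Set} (P : A → Bool) xs → (∀ {x} → x ∈ˡ xs → P x ≡ true) → allTrue P xs ≡ true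
allTrue⁺ P [] _ = refl
allTrue⁺ P (x ∷ xs) all rewrite all (here refl) = allTrue⁺ P xs (all ∘ there)

allTrue⁻ : ∀ {A : Set} (P : A → Bool) xs → allTrue P xs ≡ true → ∀ {x} → x ∈ˡ xs → P x ≡ true
allTrue⁻ P (x ∷ xs) all (here refl) = ∧-conicalˡ _ _ all
allTrue⁻ P (x ∷ xs) all (there m) = allTrue⁻ P xs (∧-conicalʳ _ _ all) m

AllPairs-++⁻ˡ : ∀ {A : Set} {R : A → A → Set} xs {ys} → AllPairs R (xs ++ ys) → AllPairs R xs
AllPairs-++⁻ˡ [] _ = []
AllPairs-++⁻ˡ (x ∷ xs) (px ∷ pxs) = All-++⁻ˡ xs px ∷ AllPairs-++⁻ˡ xs pxs

Linked-++⁻ˡ : ∀ {A : Set} {R : A → A → Set} xs {ys} → Linked R (xs ++ ys) → Linked R xs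
Linked-++⁻ˡ [] _ = []
Linked-++⁻ˡ (x ∷ []) _ = [-]
Linked-++⁻ˡ (x ∷ y ∷ xs) (r ∷ rs) = r ∷ Linked-++⁻ˡ (y ∷ xs) rs

some-member : ∀ {A : Set} {xs : List A} → 1 ≤ length xs → ∃[ a ] (a ∈ˡ xs)
some-member {xs = a ∷ _} _ = a , here refl

two-distinct : ∀ {A : Set} {xs : List A} → Unique xs → 2 ≤ length xs →
               ∃[ a ] ∃[ b ] (a ∈ˡ xs × b ∈ˡ xs × a ≢ b)
two-distinct {xs = a ∷ b ∷ _} ((a≢b ∷ _) ∷ _) _ = a , b , here refl , there (here refl) , a≢b
two-distinct {xs = _ ∷ []} _ (s≤s ())

two-satisfying : ∀ {A : Set} {P Q : A → Set} {xs : List A} → Unique xs → 3 ≤ length xs →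
                 (∀ {x} → x ∈ˡ xs → P x ⊎ Q x) →
                 (∀ {x y} → x ∈ˡ xs → y ∈ˡ xs → x ≢ y → Q x → Q y → ⊥) →
                 ∃[ a ] ∃[ b ] (a ∈ˡ xs × b ∈ˡ xs × a ≢ b × P a × P b)
two-satisfying {xs = a ∷ b ∷ c ∷ _} ((a≢b ∷ a≢c ∷ _) ∷ (b≢c ∷ _) ∷ _) _ P⊎Q at-most-one
  with P⊎Q (here refl) | P⊎Q (there (here refl)) | P⊎Q (there (there (here refl)))
... | inj₁ Pa | inj₁ Pb | _       = a , b , here refl , there (here refl) , a≢b , Pa , Pb
... | inj₁ Pa | inj₂ _  | inj₁ Pc = a , c , here refl , there (there (here refl)) , a≢c , Pa , Pc
... | inj₂ _  | inj₁ Pb | inj₁ Pc = b , c , there (here refl) , there (there (here refl)) , b≢c , Pb , Pc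
... | inj₁ _  | inj₂ Qb | inj₂ Qc = ⊥-elim (at-most-one (there (here refl)) (there (there (here refl))) b≢c Qb Qc)
... | inj₂ Qa | inj₁ _  | inj₂ Qc = ⊥-elim (at-most-one (here refl) (there (there (here refl))) a≢c Qa Qc)
... | inj₂ Qa | inj₂ Qb | _       = ⊥-elim (at-most-one (here refl) (there (here refl)) a≢b Qa Qb)
two-satisfying {xs = _ ∷ []} _ (s≤s ())
two-satisfying {xs = _ ∷ _ ∷ []} _ (s≤s (s≤s ()))

sumOver-count≡count-cartesianProduct : ∀ {A B : Set} (g : A → B → Bool) xs ys →
  sumOver (λ x → count (g x) ys) xs ≡ count (uncurry g) (cartesianProduct xs ys)
sumOver-count≡count-cartesianProduct g [] ys = refl
sumOver-count≡count-cartesianProduct g (x ∷ xs) ys =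
  trans (cong₂ _+_ (count-map ys) (sumOver-count≡count-cartesianProduct g xs ys))
        (sym (count-++ (List.map (x ,_) ys)))
  where
    count-map : ∀ ys → count (g x) ys ≡ count (uncurry g) (List.map (x ,_) ys)
    count-map [] = refl
    count-map (y ∷ ys) with g x y
    ... | true  = cong suc (count-map ys)
    ... | false = count-map ys
    count-++ : ∀ zs {ws} → count (uncurry g) (zs ++ ws) ≡ count (uncurry g) zs + count (uncurry g) ws
    count-++ [] = refl
    count-++ (z ∷ zs) with uncurry g z
    ... | true  = cong suc (count-++ zs)
    ... | false = count-++ zs

∣p∣≡count : ∀ {n} (p : Subset n) → ∣ p ∣ ≡ count (lookup p) (allFin n)
∣p∣≡count [] = refl
∣p∣≡count (true ∷ p)  = cong suc (trans (∣p∣≡count p) (sym (count-tabulate (lookup (true ∷ p)) Fin.suc)))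
∣p∣≡count (false ∷ p) = trans (∣p∣≡count p) (sym (count-tabulate (lookup (false ∷ p)) Fin.suc))

x∈p─q⇒x∉q : ∀ {n} {x : Fin n} (p q : Subset n) → x ∈ p ─ q → x ∉ q
x∈p─q⇒x∉q (_ ∷ p) (_ ∷ q) (there x∈p─q) (there x∈q) = x∈p─q⇒x∉q p q x∈p─q x∈q

module GraphFacts {n : ℕ} (G : Graph n) where

  infix 4 _~_
  _~_ : Fin n → Fin n → Set
  x ~ y = adj G x y ≡ true

  ~-sym : ∀ {x y} → x ~ y → y ~ x
  ~-sym {x} {y} x~y = trans (adj-sym G y x) x~y

  ~⇒≢ : ∀ {x y} → x ~ y → x ≢ y
  ~⇒≢ {x} x~x refl with () ← trans (sym (adj-irrefl G x)) x~x

  _~?_ : ∀ x y → Dec (x ~ y)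
  x ~? y = adj G x y ≟ᵇ true

  Leaf : Subset n → Fin n → Fin n → Set
  Leaf S u q = ∀ {y} → y ∈ S → u ~ y → y ≡ q

  Isolated : Subset n → Fin n → Set
  Isolated S x = x ∈ S × (∀ {y} → y ∈ S → ¬ x ~ y)

  record Neighbours (S : Subset n) (u : Fin n) (ys : List (Fin n)) : Set where
    field
      distinct : Unique ys
      sound    : All (λ y → y ∈ S × u ~ y) ys
      complete : ∀ {y} → y ∈ S → u ~ y → y ∈ˡ ys

  lookup⇒∈ : ∀ {S : Subset n} {x} → lookup S x ≡ true → x ∈ S
  lookup⇒∈ {S} {x} = lookup⇒[]= x S

  ∉⇒lookup≡false : ∀ {S : Subset n} {x} → x ∉ S → lookup S x ≡ false
  ∉⇒lookup≡false x∉S = ¬-not (x∉S ∘ lookup⇒∈)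

  N : Subset n → Fin n → Subset n
  N = N[_,_] G

  ∈-N⁻ : ∀ {S u x} → x ∈ N S u → x ∈ S × (x ≡ u ⊎ u ~ x)
  ∈-N⁻ {S} {u} {x} x∈N with lookup S x in Sx | x ≟ᶠ u | trans (sym (lookup∘tabulate _ x)) ([]=⇒lookup x∈N)
  ... | true | yes x≡u | _   = lookup⇒∈ Sx , inj₁ x≡u
  ... | true | no _    | u~x = lookup⇒∈ Sx , inj₂ u~x

  ∈-N⁺ : ∀ {S u x} → x ∈ S → x ≡ u ⊎ u ~ x → x ∈ N S u
  ∈-N⁺ {S} {u} {x} x∈S x≡u⊎u~x = lookup⇒∈ (trans (lookup∘tabulate _ x) (lookup-N x≡u⊎u~x))
    where
      lookup-N : x ≡ u ⊎ u ~ x → lookup S x ∧ (⌊ x ≟ᶠ u ⌋ ∨ adj G u x) ≡ true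
      lookup-N h rewrite []=⇒lookup x∈S with x ≟ᶠ u | h
      ... | yes _  | _         = refl
      ... | no x≢u | inj₁ x≡u  = ⊥-elim (x≢u x≡u)
      ... | no _   | inj₂ u~x  = u~x

  ∈-remove⁻ : ∀ {S u x} → x ∈ remove G S u → x ∈ S × x ≢ u × ¬ u ~ x
  ∈-remove⁻ {S} {u} {x} x∈R =
    x∈S , (λ x≡u → x∉N (∈-N⁺ x∈S (inj₁ x≡u))) , (λ u~x → x∉N (∈-N⁺ x∈S (inj₂ u~x)))
    where
      x∈S : x ∈ S
      x∈S = p─q⊆p S (N S u) x∈R
      x∉N : x ∉ N S u
      x∉N = x∈p─q⇒x∉q S (N S u) x∈R

  ∈-remove⁺ : ∀ {S u x} → x ∈ S → x ≢ u → ¬ u ~ x → x ∈ remove G S u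
  ∈-remove⁺ {S} {u} x∈S x≢u ¬u~x =
    x∈p∧x∉q⇒x∈p─q x∈S (λ x∈N → [ x≢u , ¬u~x ] (proj₂ (∈-N⁻ {S} {u} x∈N)))

  remove⊆ : ∀ {S u x} → x ∈ remove G S u → x ∈ S
  remove⊆ = proj₁ ∘ ∈-remove⁻

  N∩remove≡∅ : ∀ {S u x} → x ∈ N S u → x ∉ remove G S u
  N∩remove≡∅ {S} {u} x∈N x∈R = x∈p─q⇒x∉q S (N S u) x∈R x∈N

  ∉-remove⁻ : ∀ {S u x} → x ∈ S → x ∉ remove G S u → x ≡ u ⊎ u ~ x
  ∉-remove⁻ {S} {u} {x} x∈S x∉R with x ≟ᶠ u | u ~? x
  ... | yes x≡u | _       = inj₁ x≡u
  ... | no _    | yes u~x = inj₂ u~x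
  ... | no x≢u  | no ¬u~x = ⊥-elim (x∉R (∈-remove⁺ x∈S x≢u ¬u~x))

  neighbours : ∀ S u → Σ (List (Fin n)) (Neighbours S u)
  neighbours S u = filter nbr? (allFin n) , record
    { distinct = filter⁺ nbr? (allFin⁺ n)
    ; sound    = All.tabulate (proj₂ ∘ ∈-filter⁻ nbr? {xs = allFin n})
    ; complete = λ y∈S u~y → ∈-filter⁺ nbr? (∈-allFin _) (y∈S , u~y)
    }
    where
      nbr? : Decidable (λ y → y ∈ S × u ~ y)
      nbr? y = (y ∈? S) ×-dec (u ~? y)

  vS-Neighbours : ∀ {S u ys} → u ∈ S → Neighbours S u ys → vS G S u ≡ suc (length ys)
  vS-Neighbours {S} {u} {ys} u∈S nbrs = trans (∣p∣≡count (N S u)) (≤-antisym upper lower)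
    where
      open Neighbours nbrs
      within : ∀ {x} → x ∈ S × (x ≡ u ⊎ u ~ x) → x ∈ˡ u ∷ ys
      within (_   , inj₁ refl) = here refl
      within (x∈S , inj₂ u~x)  = there (complete x∈S u~x)
      inside : ∀ {x} → x ∈ˡ u ∷ ys → x ∈ N S u
      inside (here refl) = ∈-N⁺ u∈S (inj₁ refl)
      inside (there y∈ys) = let y∈S , u~y = All.lookup sound y∈ys in ∈-N⁺ y∈S (inj₂ u~y)
      upper : count (lookup (N S u)) (allFin n) ≤ length (u ∷ ys)
      upper = count-upper (lookup (N S u)) (allFin⁺ n) (λ _ → within ∘ ∈-N⁻ ∘ lookup⇒∈)
      lower : length (u ∷ ys) ≤ count (lookup (N S u)) (allFin n)
      lower = count-lower (lookup (N S u)) (All.map (~⇒≢ ∘ proj₂) sound ∷ distinct)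
                          (λ {x} x∈ → ∈-allFin x , []=⇒lookup (inside x∈))

  leaf-Neighbours : ∀ {S u q} → q ∈ S → u ~ q → Leaf S u q → Neighbours S u (q ∷ [])
  leaf-Neighbours q∈S u~q leaf = record
    { distinct = [] ∷ [] ; sound = (q∈S , u~q) ∷ [] ; complete = λ y∈S u~y → here (leaf y∈S u~y) }

  isolated-Neighbours : ∀ {S u} → Isolated S u → Neighbours S u []
  isolated-Neighbours (_ , alone) = record
    { distinct = [] ; sound = [] ; complete = λ y∈S u~y → ⊥-elim (alone y∈S u~y) }

  leaf? : ∀ S u q → Leaf S u q ⊎ ∃[ y ] (y ∈ S × u ~ y × y ≢ q)
  leaf? S u q with any? (λ y → (y ∈? S) ×-dec ((u ~? y) ×-dec ¬? (y ≟ᶠ q)))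
  ... | yes (y , y∈S , u~y , y≢q) = inj₂ (y , y∈S , u~y , y≢q)
  ... | no none = inj₁ λ {y} y∈S u~y → decidable-stable (y ≟ᶠ q) (λ y≢q → none (y , y∈S , u~y , y≢q))

  isolated? : ∀ S u → u ∈ S → Isolated S u ⊎ ∃[ y ] (y ∈ S × u ~ y)
  isolated? S u u∈S with any? (λ y → (y ∈? S) ×-dec (u ~? y))
  ... | yes nbr = inj₂ nbr
  ... | no none = inj₁ (u∈S , λ {y} y∈S u~y → none (y , y∈S , u~y))

  isEdge : Subset n → Fin n × Fin n → Bool
  isEdge S (x , y) = ⌊ x <? y ⌋ ∧ (lookup S x ∧ (lookup S y ∧ adj G x y))

  pairs : List (Fin n × Fin n)
  pairs = cartesianProduct (allFin n) (allFin n)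

  numEdges≡count : ∀ S → numEdges G S ≡ count (isEdge S) pairs
  numEdges≡count S = sumOver-count≡count-cartesianProduct (λ x y → isEdge S (x , y)) (allFin n) (allFin n)

  isEdge-mono : ∀ {R S} → (∀ {x} → x ∈ R → x ∈ S) → ∀ {e} → isEdge R e ≡ true → isEdge S e ≡ true
  isEdge-mono {R} R⊆S {x , y} e with ⌊ x <? y ⌋ | lookup R x in Rx | lookup R y in Ry | adj G x y
  ... | true | true | true | true
    rewrite []=⇒lookup (R⊆S (lookup⇒∈ {R} Rx)) | []=⇒lookup (R⊆S (lookup⇒∈ {R} Ry)) = refl

  incident : Subset n → Fin n → Fin n × Fin n → Bool
  incident S u e = isEdge S e ∧ not (isEdge (remove G S u) e)

  record Incident (S : Subset n) (u : Fin n) (e : Fin n × Fin n) : Set where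
    constructor incident✓
    field holds : incident S u e ≡ true

  eS≡count : ∀ S u → eS G S u ≡ + count (incident S u) pairs
  eS≡count S u = trans
    (cong₂ (λ a b → + a -ℤ + b)
           (trans (numEdges≡count S)
                  (count-split (isEdge R) (isEdge S) (λ {e} → isEdge-mono {R} {S} (remove⊆ {S} {u}) {e}) pairs))
           (numEdges≡count R))
    (+[m+n]-+m≡+n (count (isEdge R) pairs) _)
    where
      R : Subset n
      R = remove G S u

  eS-lower : ∀ {S u L} → Unique L → All (Incident S u) L → + length L ≤ℤ eS G S u
  eS-lower {S} {u} uL incL rewrite eS≡count S u =
    +≤+ (count-lower (incident S u) uL λ { {x , y} e∈L →
           ∈-cartesianProduct⁺ (∈-allFin x) (∈-allFin y) , Incident.holds (All.lookup incL e∈L) })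

  link : Fin n → Fin n → Fin n × Fin n
  link a b = if ⌊ a <? b ⌋ then (a , b) else (b , a)

  link-injective : ∀ {a b c d} → link a b ≡ link c d → (a ≡ c × b ≡ d) ⊎ (a ≡ d × b ≡ c)
  link-injective {a} {b} {c} {d} e with ⌊ a <? b ⌋ | ⌊ c <? d ⌋
  link-injective refl | true  | true  = inj₁ (refl , refl)
  link-injective refl | true  | false = inj₂ (refl , refl)
  link-injective refl | false | true  = inj₂ (refl , refl)
  link-injective refl | false | false = inj₁ (refl , refl)

  link-≢ˡ : ∀ {a b c d} → a ≢ c → a ≢ d → link a b ≢ link c d
  link-≢ˡ a≢c a≢d e = [ a≢c ∘ proj₁ , a≢d ∘ proj₁ ] (link-injective e)

  isEdge⁺ : ∀ {S a b} → ⌊ a <? b ⌋ ≡ true → a ∈ S → b ∈ S → a ~ b → isEdge S (a , b) ≡ true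
  isEdge⁺ {S} {a} {b} a<b a∈S b∈S a~b = cong₂ _∧_ a<b inside
    where
      inside : lookup S a ∧ (lookup S b ∧ adj G a b) ≡ true
      inside rewrite []=⇒lookup a∈S | []=⇒lookup b∈S = a~b

  isEdge-link : ∀ {S a b} → a ∈ S → b ∈ S → a ~ b → isEdge S (link a b) ≡ true
  isEdge-link {S} {a} {b} a∈S b∈S a~b with ⌊ a <? b ⌋ in a<b
  ... | true  = isEdge⁺ a<b a∈S b∈S a~b
  ... | false = isEdge⁺ (⌊⌋-true (b <? a) b<a) b∈S a∈S (~-sym a~b)
    where
      b<a : b Fin.< a
      b<a = ≤∧≢⇒< (≮⇒≥ (λ a<b′ → true≢false (trans (sym (⌊⌋-true (a <? b) a<b′)) a<b)))
                  (~⇒≢ (~-sym a~b))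

  isEdge-link-∉ : ∀ {S a b} → lookup S a ≡ false → isEdge S (link a b) ≡ false
  isEdge-link-∉ {S} {a} {b} Sa with ⌊ a <? b ⌋
  ... | true  rewrite Sa = ∧-zeroʳ _
  ... | false rewrite Sa = trans (cong (⌊ b <? a ⌋ ∧_) (∧-zeroʳ (lookup S b))) (∧-zeroʳ _)

  incident-link : ∀ {S u a b} → a ∈ N S u → b ∈ S → a ~ b → Incident S u (link a b)
  incident-link {S} {u} {a} {b} a∈N b∈S a~b = incident✓ $
    ∧-not-intro (isEdge-link {S} (proj₁ (∈-N⁻ a∈N)) b∈S a~b)
                (isEdge-link-∉ {remove G S u} {b = b} (∉⇒lookup≡false (N∩remove≡∅ {S} {u} a∈N)))

  spokes : Fin n → List (Fin n) → List (Fin n × Fin n)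
  spokes d = map (link d)

  ∈-spokes⁻ : ∀ {a b d xs} → link a b ∈ˡ spokes d xs → a ≡ d ⊎ (a ∈ˡ xs × b ≡ d)
  ∈-spokes⁻ {d = d} ab∈ with ∈-map⁻ (link d) ab∈
  ... | x , x∈xs , e with link-injective e
  ...   | inj₁ (a≡d , _)      = inj₁ a≡d
  ...   | inj₂ (refl , b≡d)   = inj₂ (x∈xs , b≡d)

  ∉-spokes : ∀ {a b d xs} → a ≢ d → b ≢ d → link a b ∉ˡ spokes d xs
  ∉-spokes a≢d b≢d ab∈ = [ a≢d , b≢d ∘ proj₂ ] (∈-spokes⁻ ab∈)

  eS-lower-spokes : ∀ {S u d xs L} → d ∈ N S u → Unique xs → All (λ x → x ∈ S × d ~ x) xs →
                    Unique L → All (Incident S u) L → All (_∉ˡ spokes d xs) L →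
                    + (length L + length xs) ≤ℤ eS G S u
  eS-lower-spokes {S} {u} {d} {xs} {L} d∈N uxs nbrs uL incL L∉ =
    subst (λ m → + m ≤ℤ eS G S u) length-L++spokes
      (eS-lower (Unique-++⁺ uL spokes-unique (λ (e∈L , e∈sp) → All.lookup L∉ e∈L e∈sp))
                (All-++⁺ incL (All-map⁺ (All.map (λ (x∈S , d~x) → incident-link d∈N x∈S d~x) nbrs))))
    where
      spokes-unique : Unique (spokes d xs)
      spokes-unique = Unique-map⁺ link-injectiveʳ uxs
        where
          link-injectiveʳ : ∀ {x y} → link d x ≡ link d y → x ≡ y
          link-injectiveʳ e = [ proj₂ , (λ (d≡y , x≡d) → trans x≡d d≡y) ] (link-injective e)
      length-L++spokes : length (L ++ spokes d xs) ≡ length L + length xs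
      length-L++spokes = trans (length-++ L) (cong (λ m → length L + m) (length-map (link d) xs))

  iso : Subset n → Fin n → Bool
  iso S x = lookup S x ∧ allTrue (λ y → not (lookup S y ∧ adj G x y)) (allFin n)

  iso⁺ : ∀ {S x} → Isolated S x → iso S x ≡ true
  iso⁺ {S} {x} (x∈S , alone) rewrite []=⇒lookup x∈S = allTrue⁺ _ (allFin n) (λ {y} _ → not-adjacent y)
    where
      not-adjacent : ∀ y → not (lookup S y ∧ adj G x y) ≡ true
      not-adjacent y with lookup S y in Sy | adj G x y in x~y
      ... | true  | true  = ⊥-elim (alone (lookup⇒∈ Sy) x~y)
      ... | true  | false = refl
      ... | false | _     = refl

  iso⁻ : ∀ {S x} → iso S x ≡ true → Isolated S x
  iso⁻ {S} {x} e = lookup⇒∈ (∧-conicalˡ _ _ e) , not-adjacent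
    where
      not-adjacent : ∀ {y} → y ∈ S → ¬ x ~ y
      not-adjacent {y} y∈S x~y with allTrue⁻ _ (allFin n) (∧-conicalʳ _ _ e) (∈-allFin y)
      ... | h rewrite []=⇒lookup y∈S | x~y with () ← h

  kS≡gain : ∀ {S u} → (∀ {x} → Isolated S x → Isolated (remove G S u) x) →
            kS G S u ≡ + count (λ x → iso (remove G S u) x ∧ not (iso S x)) (allFin n)
  kS≡gain {S} {u} stays =
    trans (cong (λ m → + m -ℤ + numIsolated G S)
                (count-split (iso S) (iso R) (iso⁺ ∘ stays ∘ iso⁻) (allFin n)))
          (+[m+n]-+m≡+n (numIsolated G S) _)
    where
      R : Subset n
      R = remove G S u

  -- Removing N[u] for a non-isolated u keeps every isolated vertex, and c becomes a new one.
  kS-positive : ∀ {S u t c t′} → u ∈ S → t ∈ S → u ~ t →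
                c ∈ remove G S u → t′ ∈ S → c ~ t′ → (∀ {y} → y ∈ S → c ~ y → y ∈ N S u) →
                + 1 ≤ℤ kS G S u
  kS-positive {S} {u} {t} {c} {t′} u∈S t∈S u~t c∈R t′∈S c~t′ N[c]⊆N[u] =
    subst (+ 1 ≤ℤ_) (sym (kS≡gain stays))
      (+≤+ (count-lower _ ([] ∷ []) λ { (here refl) →
              ∈-allFin c , ∧-not-intro (iso⁺ c-isolated) c-not-isolated }))
    where
      R : Subset n
      R = remove G S u
      stays : ∀ {x} → Isolated S x → Isolated R x
      stays {x} (x∈S , alone) =
        ∈-remove⁺ x∈S (λ { refl → alone t∈S u~t }) (λ u~x → alone u∈S (~-sym u~x)) , alone ∘ remove⊆
      c-isolated : Isolated R c
      c-isolated = c∈R , λ y∈R c~y → N∩remove≡∅ (N[c]⊆N[u] (remove⊆ y∈R) c~y) y∈R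
      c-not-isolated : iso S c ≡ false
      c-not-isolated = ¬-not (λ e → proj₂ (iso⁻ e) t′∈S c~t′)

  kS-isolated : ∀ {S u} → Isolated S u → kS G S u ≡ -[1+ 0 ]
  kS-isolated {S} {u} (u∈S , alone) = begin
      + numIsolated G R -ℤ + numIsolated G S
    ≡⟨ cong (λ m → + numIsolated G R -ℤ + m)
            (count-split (iso R) (iso S) (iso⁺ ∘ returns ∘ iso⁻) (allFin n)) ⟩
      + numIsolated G R -ℤ + (numIsolated G R + lost)
    ≡⟨ cong (λ m → + numIsolated G R -ℤ + (numIsolated G R + m)) lost≡1 ⟩
      + numIsolated G R -ℤ + (numIsolated G R + 1)
    ≡⟨ +m-+[m+1]≡-1 (numIsolated G R) ⟩
      -[1+ 0 ]
    ∎
    where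
      open ≡-Reasoning
      R : Subset n
      R = remove G S u
      lost : ℕ
      lost = count (λ x → iso S x ∧ not (iso R x)) (allFin n)
      returns : ∀ {x} → Isolated R x → Isolated S x
      returns {x} (x∈R , aloneᴿ) = remove⊆ x∈R , λ {y} y∈S x~y → case y∈S x~y (y ∈? R)
        where
          case : ∀ {y} → y ∈ S → x ~ y → Dec (y ∈ R) → ⊥
          case _   x~y (yes y∈R) = aloneᴿ y∈R x~y
          case y∈S x~y (no y∉R) with ∉-remove⁻ y∈S y∉R
          ... | inj₁ refl = alone (remove⊆ x∈R) (~-sym x~y)
          ... | inj₂ u~y  = alone y∈S u~y
      only-u : ∀ {x} → x ∈ˡ allFin n → iso S x ∧ not (iso R x) ≡ true → x ∈ˡ u ∷ []
      only-u {x} _ e with x ≟ᶠ u | ∧-not-elim (iso S x) (iso R x) e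
      ... | yes x≡u | _ = here x≡u
      ... | no x≢u  | isoS , notR with iso⁻ isoS
      ...   | x∈S , aloneˣ =
              ⊥-elim (true≢false (trans (sym (iso⁺ x-isolated-after)) notR))
        where
          x-isolated-after : Isolated R x
          x-isolated-after = ∈-remove⁺ x∈S x≢u (alone x∈S) , aloneˣ ∘ remove⊆
      u∉R : u ∉ R
      u∉R = N∩remove≡∅ (∈-N⁺ u∈S (inj₁ refl))
      lost≡1 : lost ≡ 1
      lost≡1 = ≤-antisym
        (count-upper _ (allFin⁺ n) only-u)
        (count-lower _ ([] ∷ []) λ { (here refl) →
          ∈-allFin u , ∧-not-intro (iso⁺ (u∈S , alone)) (¬-not (u∉R ∘ proj₁ ∘ iso⁻ {R})) })

module ForestFacts {n : ℕ} (G : Graph n) (forest : IsForest G) where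

  open GraphFacts G
  open import Data.List.Membership.DecPropositional (_≟ᶠ_ {n}) using () renaming (_∈?_ to _∈ˡ?_)

  no-cycle : ∀ x y zs z → Unique ((x ∷ y ∷ zs) List.∷ʳ z) → Linked _~_ ((x ∷ y ∷ zs) List.∷ʳ z) →
             z ~ x → ⊥
  no-cycle x y zs z distinct path closing = forest record
    { first = x ; middle = y ∷ zs ; lastv = z ; middle-nonempty = s≤s z≤n
    ; distinct = distinct ; path = path ; closing = closing }

  no-triangle : ∀ {a b c} → a ~ b → b ~ c → c ~ a → ⊥
  no-triangle {a} {b} {c} a~b b~c c~a = no-cycle a b [] c
    ((~⇒≢ a~b ∷ ≢-sym (~⇒≢ c~a) ∷ []) ∷ (~⇒≢ b~c ∷ []) ∷ [] ∷ [])
    (a~b ∷ b~c ∷ [-]) c~a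

  no-4-cycle : ∀ {a b c d} → a ~ b → b ~ c → c ~ d → d ~ a → a ≢ c → b ≢ d → ⊥
  no-4-cycle {a} {b} {c} {d} a~b b~c c~d d~a a≢c b≢d = no-cycle a b (c ∷ []) d
    ((~⇒≢ a~b ∷ a≢c ∷ ≢-sym (~⇒≢ d~a) ∷ []) ∷ (~⇒≢ b~c ∷ b≢d ∷ []) ∷ (~⇒≢ c~d ∷ []) ∷ []
      ∷ [])
    (a~b ∷ b~c ∷ c~d ∷ [-]) d~a

  no-6-cycle : ∀ {a b c d e f} → a ~ b → b ~ c → c ~ d → d ~ e → e ~ f → f ~ a →
               a ≢ c → a ≢ d → a ≢ e → b ≢ d → b ≢ e → b ≢ f → c ≢ e → c ≢ f → d ≢ f → ⊥
  no-6-cycle {a} {b} {c} {d} {e} {f} a~b b~c c~d d~e e~f f~a a≢c a≢d a≢e b≢d b≢e b≢f c≢e c≢f d≢f =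
    no-cycle a b (c ∷ d ∷ e ∷ []) f
      ((~⇒≢ a~b ∷ a≢c ∷ a≢d ∷ a≢e ∷ ≢-sym (~⇒≢ f~a) ∷ [])
        ∷ (~⇒≢ b~c ∷ b≢d ∷ b≢e ∷ b≢f ∷ [])
        ∷ (~⇒≢ c~d ∷ c≢e ∷ c≢f ∷ [])
        ∷ (~⇒≢ d~e ∷ d≢f ∷ [])
        ∷ (~⇒≢ e~f ∷ [])
        ∷ []
        ∷ [])
      (a~b ∷ b~c ∷ c~d ∷ d~e ∷ e~f ∷ [-]) f~a

  record Path (S : Subset n) (xs : List (Fin n)) : Set where
    field
      distinct : Unique xs
      linked   : Linked _~_ xs
      inside   : All (_∈ S) xs
  open Path

  no-chord : ∀ {S z q r w} → Path S (z ∷ q ∷ r) → w ∈ˡ r → ¬ z ~ w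
  no-chord {z = z} {q} {r} {w} P w∈r z~w with ∈-∃++ w∈r
  ... | r₁ , r₂ , refl =
    no-cycle z q r₁ w (AllPairs-++⁻ˡ (z ∷ q ∷ r₁ List.∷ʳ w) (subst Unique split (distinct P)))
                      (Linked-++⁻ˡ (z ∷ q ∷ r₁ List.∷ʳ w) (subst (Linked _~_) split (linked P)))
                      (~-sym z~w)
    where
      split : z ∷ q ∷ r₁ ++ w ∷ r₂ ≡ (z ∷ q ∷ r₁ List.∷ʳ w) ++ r₂
      split = cong (λ t → z ∷ q ∷ t) (sym (++-assoc r₁ (w ∷ []) r₂))

  record LeafPath (S : Subset n) (m : ℕ) : Set where
    field
      leaf stem : Fin n
      rest      : List (Fin n)
      path      : Path S (leaf ∷ stem ∷ rest)
      hangs     : Leaf S leaf stem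
      long      : m ≤ length rest

  -- Extend the path at its first vertex while that vertex has another neighbour; by no-chord the
  -- result is again a path, so the fuel k (at most n steps) suffices to reach a leaf.
  grow-to-leaf : ∀ {S} k {z q r} → n < length (z ∷ q ∷ r) + k → Path S (z ∷ q ∷ r) → LeafPath S (length r)
  grow-to-leaf zero lt P =
    ⊥-elim (<⇒≱ (subst (n <_) (+-identityʳ _) lt)
                (≤-trans (length-mono-⊆ (distinct P) (λ {x} _ → ∈-allFin x)) (≤-reflexive (length-tabulate _))))
  grow-to-leaf {S} (suc k) {z} {q} {r} lt P with leaf? S z q
  ... | inj₁ hangs = record { leaf = z ; stem = q ; rest = r ; path = P ; hangs = hangs ; long = ≤-refl }
  ... | inj₂ (w , w∈S , z~w , w≢q) with w ∈ˡ? r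
  ...   | yes w∈r = ⊥-elim (no-chord P w∈r z~w)
  ...   | no w∉r  = shorten (grow-to-leaf k (subst (n <_) (+-suc _ k) lt) longer)
    where
      longer : Path S (w ∷ z ∷ q ∷ r)
      longer = record
        { distinct = (≢-sym (~⇒≢ z~w) ∷ w≢q ∷ ¬Any⇒All¬ r w∉r) ∷ distinct P
        ; linked   = ~-sym z~w ∷ linked P
        ; inside   = w∈S ∷ inside P }
      shorten : LeafPath S (length (q ∷ r)) → LeafPath S (length r)
      shorten lp = record { LeafPath lp ; long = ≤-trans (n≤1+n _) (LeafPath.long lp) }

  leaf-path : ∀ {S z q r} → Path S (z ∷ q ∷ r) → LeafPath S (length r)
  leaf-path = grow-to-leaf n (m<n+m n (s≤s z≤n))

  pendant-edge : ∀ {S x y} → x ∈ S → y ∈ S → x ~ y →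
                 ∃[ w ] (w ∈ S × vS G S w ≡ 2 × + 1 ≤ℤ eS G S w)
  pendant-edge {S} {x} {y} x∈S y∈S x~y = pendant (leaf-path P)
    where
      P : Path S (x ∷ y ∷ [])
      P = record { distinct = (~⇒≢ x~y ∷ []) ∷ [] ∷ [] ; linked = x~y ∷ [-] ; inside = x∈S ∷ y∈S ∷ [] }
      pendant : LeafPath S 0 → ∃[ w ] (w ∈ S × vS G S w ≡ 2 × + 1 ≤ℤ eS G S w)
      pendant record { leaf = w ; path = record { linked = w~q ∷ _ ; inside = w∈S ∷ q∈S ∷ _ } ; hangs = hangs } =
        w , w∈S , vS-Neighbours w∈S (leaf-Neighbours q∈S w~q hangs)
          , eS-lower ([] ∷ []) (incident-link (∈-N⁺ w∈S (inj₁ refl)) q∈S w~q ∷ [])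

  pendant-path₃ : ∀ {S x y z} → x ∈ S → y ∈ S → z ∈ S → x ~ y → y ~ z → x ≢ z →
                  ∃[ w ] (w ∈ S × vS G S w ≡ 2 × + 2 ≤ℤ eS G S w)
  pendant-path₃ {S} {x} {y} {z} x∈S y∈S z∈S x~y y~z x≢z = pendant (leaf-path P)
    where
      P : Path S (x ∷ y ∷ z ∷ [])
      P = record
        { distinct = (~⇒≢ x~y ∷ x≢z ∷ []) ∷ (~⇒≢ y~z ∷ []) ∷ [] ∷ []
        ; linked = x~y ∷ y~z ∷ [-] ; inside = x∈S ∷ y∈S ∷ z∈S ∷ [] }
      pendant : LeafPath S 1 → ∃[ w ] (w ∈ S × vS G S w ≡ 2 × + 2 ≤ℤ eS G S w)
      pendant record { leaf = w ; rest = v ∷ _ ; hangs = hangs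
                     ; path = record { distinct = (_ ∷ w≢v ∷ _) ∷ _
                                     ; linked = w~q ∷ q~v ∷ _
                                     ; inside = w∈S ∷ q∈S ∷ v∈S ∷ _ } } =
        w , w∈S , vS-Neighbours w∈S (leaf-Neighbours q∈S w~q hangs)
          , eS-lower ((link-≢ˡ (~⇒≢ w~q) w≢v ∷ []) ∷ [] ∷ [])
              (incident-link (∈-N⁺ w∈S (inj₁ refl)) q∈S w~q
               ∷ incident-link (∈-N⁺ q∈S (inj₂ w~q)) v∈S q~v ∷ [])

  pendant-or-isolated : ∀ {S u} → u ∈ S →
    ∃[ w ] (w ∈ S × ((vS G S w ≡ 2 × + 1 ≤ℤ eS G S w) ⊎ (vS G S w ≡ 1 × kS G S w ≡ -[1+ 0 ])))
  pendant-or-isolated {S} {u} u∈S with isolated? S u u∈S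
  ... | inj₁ alone = u , u∈S , inj₂ (vS-Neighbours u∈S (isolated-Neighbours alone) , kS-isolated alone)
  ... | inj₂ (y , y∈S , u~y) with pendant-edge u∈S y∈S u~y
  ...   | w , w∈S , pendant = w , w∈S , inj₁ pendant

module Round {n : ℕ} (G : Graph n) (forest : IsForest G) (H : Subset n) {wS : Fin n} (wS∈H : wS ∈ H)
             {d : Fin n} (d∈S₁ : d ∈ remove G H wS)
             {ys : List (Fin n)} (d-nbrs : GraphFacts.Neighbours G (remove G H wS) d ys) where

  -- H is F_{i-1}^D, wS and d are the i-th moves w_i^S and w_i^D, and S₁ below is F_i^S.

  open GraphFacts G
  open ForestFacts G forest
  open Neighbours d-nbrs

  S₁ : Subset n
  S₁ = remove G H wS

  d∈H : d ∈ H
  d∈H = remove⊆ d∈S₁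

  ∈S₁⇒≢wS : ∀ {x} → x ∈ S₁ → x ≢ wS
  ∈S₁⇒≢wS = proj₁ ∘ proj₂ ∘ ∈-remove⁻

  ∈S₁⇒≢N[wS] : ∀ {x y} → x ∈ S₁ → wS ~ y → x ≢ y
  ∈S₁⇒≢N[wS] x∈S₁ wS~y refl = proj₂ (proj₂ (∈-remove⁻ x∈S₁)) wS~y

  spoke : ∀ {x} → x ∈ˡ ys → x ∈ S₁ × d ~ x
  spoke = All.lookup sound

  spoke∈H : ∀ {x} → x ∈ˡ ys → x ∈ H
  spoke∈H = remove⊆ ∘ proj₁ ∘ spoke

  spoke≢d : ∀ {x} → x ∈ˡ ys → x ≢ d
  spoke≢d = ≢-sym ∘ ~⇒≢ ∘ proj₂ ∘ spoke

  Branch : Subset n → Fin n → Set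
  Branch S x = ∃[ y ] (y ∈ S × x ~ y × y ≢ d)

  branch-to-wS : ∀ {x y} → x ∈ S₁ → Leaf S₁ x d → y ∈ H → x ~ y → y ≢ d → wS ~ y
  branch-to-wS {x} {y} x∈S₁ leaf y∈H x~y y≢d with y ∈? S₁
  ... | yes y∈S₁ = ⊥-elim (y≢d (leaf y∈S₁ x~y))
  ... | no y∉S₁ with ∉-remove⁻ y∈H y∉S₁
  ...   | inj₁ refl = ⊥-elim (∈S₁⇒≢N[wS] x∈S₁ (~-sym x~y) refl)
  ...   | inj₂ wS~y = wS~y

  two-spokes-to-N[wS] : ∀ {x₁ x₂ y₁ y₂} → x₁ ∈ S₁ → x₂ ∈ S₁ → x₁ ≢ x₂ → d ~ x₁ → d ~ x₂ →
                        wS ~ y₁ → wS ~ y₂ → x₁ ~ y₁ → x₂ ~ y₂ → ⊥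
  two-spokes-to-N[wS] {y₁ = y₁} {y₂} x₁∈S₁ x₂∈S₁ x₁≢x₂ d~x₁ d~x₂ wS~y₁ wS~y₂ x₁~y₁ x₂~y₂ with y₁ ≟ᶠ y₂
  ... | yes refl =
    no-4-cycle (~-sym d~x₁) d~x₂ x₂~y₂ (~-sym x₁~y₁) x₁≢x₂ (∈S₁⇒≢N[wS] d∈S₁ wS~y₁)
  ... | no y₁≢y₂ =
    no-6-cycle (~-sym d~x₁) d~x₂ x₂~y₂ (~-sym wS~y₂) wS~y₁ (~-sym x₁~y₁)
      x₁≢x₂ (∈S₁⇒≢N[wS] x₁∈S₁ wS~y₂) (∈S₁⇒≢wS x₁∈S₁)
      (∈S₁⇒≢N[wS] d∈S₁ wS~y₂) (∈S₁⇒≢wS d∈S₁) (∈S₁⇒≢N[wS] d∈S₁ wS~y₁)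
      (∈S₁⇒≢wS x₂∈S₁) (∈S₁⇒≢N[wS] x₂∈S₁ wS~y₁) (≢-sym y₁≢y₂)

  two-branches : ∀ {x₁ x₂} → x₁ ∈ˡ ys → x₂ ∈ˡ ys → x₁ ≢ x₂ → Leaf S₁ x₁ d → Leaf S₁ x₂ d →
                 Branch H x₁ → Branch H x₂ → ⊥
  two-branches {x₁} {x₂} x₁∈ x₂∈ x₁≢x₂ leaf₁ leaf₂ (_ , y₁∈H , x₁~y₁ , y₁≢d) (_ , y₂∈H , x₂~y₂ , y₂≢d) =
    two-spokes-to-N[wS] x₁∈S₁ x₂∈S₁ x₁≢x₂ (proj₂ (spoke x₁∈)) (proj₂ (spoke x₂∈))
      (branch-to-wS x₁∈S₁ leaf₁ y₁∈H x₁~y₁ y₁≢d) (branch-to-wS x₂∈S₁ leaf₂ y₂∈H x₂~y₂ y₂≢d) x₁~y₁ x₂~y₂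
    where
      x₁∈S₁ : x₁ ∈ S₁
      x₁∈S₁ = proj₁ (spoke x₁∈)
      x₂∈S₁ : x₂ ∈ S₁
      x₂∈S₁ = proj₁ (spoke x₂∈)

  IsolatingMove : ℕ → ℕ → Fin n → Set
  IsolatingMove v e w = vS G H w ≡ v × + e ≤ℤ eS G H w × + 1 ≤ℤ kS G H w

  eS-lower-at-spoke : ∀ {a L} → a ∈ˡ ys → Unique L → All (Incident H a) L → All (_∉ˡ spokes d ys) L →
                      + (length L + length ys) ≤ℤ eS G H a
  eS-lower-at-spoke a∈ = eS-lower-spokes (∈-N⁺ d∈H (inj₂ (~-sym (proj₂ (spoke a∈))))) distinct
                                          (All.map (λ (x∈S₁ , d~x) → remove⊆ x∈S₁ , d~x) sound)

  partner-isolated : ∀ {a b} → a ∈ˡ ys → b ∈ˡ ys → a ≢ b → ¬ a ~ b → Leaf H b d → + 1 ≤ℤ kS G H a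
  partner-isolated {a} a∈ b∈ a≢b a≁b leaf-b =
    kS-positive (spoke∈H a∈) d∈H a~d (∈-remove⁺ (spoke∈H b∈) (≢-sym a≢b) a≁b)
                d∈H (~-sym (proj₂ (spoke b∈)))
                (λ y∈H b~y → subst (_∈ N H _) (sym (leaf-b y∈H b~y)) (∈-N⁺ d∈H (inj₂ a~d)))
    where
      a~d : a ~ d
      a~d = ~-sym (proj₂ (spoke a∈))

  leaf-move : ∀ {a b} → a ∈ˡ ys → b ∈ˡ ys → a ≢ b → Leaf H a d → Leaf H b d →
              IsolatingMove 2 (length ys) a
  leaf-move a∈ b∈ a≢b leaf-a leaf-b =
    vS-Neighbours (spoke∈H a∈) (leaf-Neighbours d∈H (~-sym (proj₂ (spoke a∈))) leaf-a) ,
    eS-lower-at-spoke a∈ [] [] [] ,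
    partner-isolated a∈ b∈ a≢b (λ a~b → spoke≢d b∈ (leaf-a (spoke∈H b∈) a~b)) leaf-b

  branch-move : ∀ {a b y} → a ∈ˡ ys → b ∈ˡ ys → a ≢ b → Leaf S₁ a d → y ∈ H → a ~ y → y ≢ d →
                Leaf H b d → IsolatingMove 3 (2 + length ys) a
  branch-move {a} {b} {y} a∈ b∈ a≢b leaf-a y∈H a~y y≢d leaf-b =
    vS-Neighbours a∈H N[a] ,
    eS-lower-at-spoke a∈ ((link-≢ˡ a≢y (∈S₁⇒≢wS a∈S₁) ∷ []) ∷ [] ∷ [])
      (incident-link a∈N[a] y∈H a~y ∷ incident-link (∈-N⁺ y∈H (inj₂ a~y)) wS∈H (~-sym wS~y) ∷ [])
      (∉-spokes (spoke≢d a∈) y≢d ∷ ∉-spokes y≢d (≢-sym (∈S₁⇒≢wS d∈S₁)) ∷ []) ,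
    partner-isolated a∈ b∈ a≢b
      (λ a~b → [ spoke≢d b∈ , ∈S₁⇒≢N[wS] b∈S₁ wS~y ] (only-d-y (spoke∈H b∈) a~b)) leaf-b
    where
      a∈S₁ : a ∈ S₁
      a∈S₁ = proj₁ (spoke a∈)
      b∈S₁ : b ∈ S₁
      b∈S₁ = proj₁ (spoke b∈)
      a∈H : a ∈ H
      a∈H = spoke∈H a∈
      a~d : a ~ d
      a~d = ~-sym (proj₂ (spoke a∈))
      a∈N[a] : a ∈ N H a
      a∈N[a] = ∈-N⁺ a∈H (inj₁ refl)
      wS~y : wS ~ y
      wS~y = branch-to-wS a∈S₁ leaf-a y∈H a~y y≢d
      a≢y : a ≢ y
      a≢y = ∈S₁⇒≢N[wS] a∈S₁ wS~y
      only-d-y : ∀ {x} → x ∈ H → a ~ x → x ≡ d ⊎ x ≡ y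
      only-d-y {x} x∈H a~x with x ≟ᶠ d | x ≟ᶠ y
      ... | yes x≡d | _       = inj₁ x≡d
      ... | no _    | yes x≡y = inj₂ x≡y
      ... | no x≢d  | no x≢y  =
        ⊥-elim (no-4-cycle a~y (~-sym wS~y) (branch-to-wS a∈S₁ leaf-a x∈H a~x x≢d) (~-sym a~x)
                           (∈S₁⇒≢wS a∈S₁) (≢-sym x≢y))
      N[a] : Neighbours H a (d ∷ y ∷ [])
      N[a] = record
        { distinct = (∈S₁⇒≢N[wS] d∈S₁ wS~y ∷ []) ∷ [] ∷ []
        ; sound    = (d∈H , a~d) ∷ (y∈H , a~y) ∷ []
        ; complete = λ x∈H a~x → listed (only-d-y x∈H a~x) }
        where
          listed : ∀ {x} → x ≡ d ⊎ x ≡ y → x ∈ˡ d ∷ y ∷ []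
          listed (inj₁ x≡d) = here x≡d
          listed (inj₂ x≡y) = there (here x≡y)

  pendant-pair : ∀ {a b} → a ∈ˡ ys → b ∈ˡ ys → a ≢ b → Leaf S₁ a d → Leaf S₁ b d →
                 ∃[ w ] (w ∈ H × (IsolatingMove 2 (length ys) w ⊎ IsolatingMove 3 (2 + length ys) w))
  pendant-pair {a} {b} a∈ b∈ a≢b leaf-a leaf-b with leaf? H a d | leaf? H b d
  ... | inj₁ leafᴴ-a | inj₁ leafᴴ-b =
        a , spoke∈H a∈ , inj₁ (leaf-move a∈ b∈ a≢b leafᴴ-a leafᴴ-b)
  ... | inj₂ (y , y∈H , a~y , y≢d) | inj₁ leafᴴ-b =
        a , spoke∈H a∈ , inj₂ (branch-move a∈ b∈ a≢b leaf-a y∈H a~y y≢d leafᴴ-b)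
  ... | inj₁ leafᴴ-a | inj₂ (y , y∈H , b~y , y≢d) =
        b , spoke∈H b∈ , inj₂ (branch-move b∈ a∈ (≢-sym a≢b) leaf-b y∈H b~y y≢d leafᴴ-a)
  ... | inj₂ branch-a | inj₂ branch-b =
        ⊥-elim (two-branches a∈ b∈ a≢b leaf-a leaf-b branch-a branch-b)

  spoke-bound : ∀ {L m} → eS G S₁ d ≡ + m → Unique L → All (Incident S₁ d) L → All (_∉ˡ spokes d ys) L →
                length L + length ys ≤ m
  spoke-bound eS≡ uL incL L∉ =
    drop‿+≤+ (subst (_ ≤ℤ_) eS≡ (eS-lower-spokes (∈-N⁺ d∈S₁ (inj₁ refl)) distinct sound uL incL L∉))

  incident-off-spoke : ∀ {x z} → x ∈ˡ ys → z ∈ S₁ → x ~ z → Incident S₁ d (link x z)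
  incident-off-spoke x∈ z∈S₁ x~z =
    incident-link (∈-N⁺ (proj₁ (spoke x∈)) (inj₂ (proj₂ (spoke x∈)))) z∈S₁ x~z

  tight⇒leaf : eS G S₁ d ≡ + length ys → ∀ {x} → x ∈ˡ ys → Leaf S₁ x d
  tight⇒leaf eS≡ {x} x∈ with leaf? S₁ x d
  ... | inj₁ leaf = leaf
  ... | inj₂ (z , z∈S₁ , x~z , z≢d) =
        ⊥-elim (n≮n _ (spoke-bound eS≡ ([] ∷ []) (incident-off-spoke x∈ z∈S₁ x~z ∷ [])
                                              (∉-spokes (spoke≢d x∈) z≢d ∷ [])))

  loose⇒one-branch : eS G S₁ d ≡ + (length ys + 1) → ∀ {x₁ x₂} → x₁ ∈ˡ ys → x₂ ∈ˡ ys → x₁ ≢ x₂ →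
                     Branch S₁ x₁ → Branch S₁ x₂ → ⊥
  loose⇒one-branch eS≡ {x₁} {x₂} x₁∈ x₂∈ x₁≢x₂ (z₁ , z₁∈S₁ , x₁~z₁ , z₁≢d)
                   (z₂ , z₂∈S₁ , x₂~z₂ , z₂≢d) =
    n≮n _ (subst (2 + length ys ≤_) (+-comm (length ys) 1)
      (spoke-bound eS≡ ((distinct-extras ∷ []) ∷ [] ∷ [])
        (incident-off-spoke x₁∈ z₁∈S₁ x₁~z₁ ∷ incident-off-spoke x₂∈ z₂∈S₁ x₂~z₂ ∷ [])
        (∉-spokes (spoke≢d x₁∈) z₁≢d ∷ ∉-spokes (spoke≢d x₂∈) z₂≢d ∷ [])))
    where
      distinct-extras : link x₁ z₁ ≢ link x₂ z₂
      distinct-extras e with link-injective e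
      ... | inj₁ (x₁≡x₂ , _)    = x₁≢x₂ x₁≡x₂
      ... | inj₂ (_ , refl)     = no-triangle (proj₂ (spoke x₁∈)) x₁~z₁ (~-sym (proj₂ (spoke x₂∈)))

  tight-pair : ∀ {l} → length ys ≡ l → eS G S₁ d ≡ + l → 2 ≤ l →
               ∃[ w ] (w ∈ H × (IsolatingMove 2 l w ⊎ IsolatingMove 3 (2 + l) w))
  tight-pair refl eS≡ 2≤l with two-distinct distinct 2≤l
  ... | a , b , a∈ , b∈ , a≢b = pendant-pair a∈ b∈ a≢b (tight⇒leaf eS≡ a∈) (tight⇒leaf eS≡ b∈)

  tight-triple : ∀ {l} → length ys ≡ l → eS G S₁ d ≡ + l → 3 ≤ l →
                 ∃[ w ] (w ∈ H × IsolatingMove 2 l w)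
  tight-triple refl eS≡ 3≤l
    with two-satisfying distinct 3≤l (λ _ → leaf? H _ d)
           (λ x∈ y∈ x≢y → two-branches x∈ y∈ x≢y (tight⇒leaf eS≡ x∈) (tight⇒leaf eS≡ y∈))
  ... | a , b , a∈ , b∈ , a≢b , leaf-a , leaf-b = a , spoke∈H a∈ , leaf-move a∈ b∈ a≢b leaf-a leaf-b

  loose-triple : ∀ {l} → length ys ≡ l → eS G S₁ d ≡ + (l + 1) → 3 ≤ l →
                 ∃[ w ] (w ∈ H × (IsolatingMove 2 l w ⊎ IsolatingMove 3 (2 + l) w))
  loose-triple refl eS≡ 3≤l with two-satisfying distinct 3≤l (λ _ → leaf? S₁ _ d) (loose⇒one-branch eS≡)
  ... | a , b , a∈ , b∈ , a≢b , leaf-a , leaf-b = pendant-pair a∈ b∈ a≢b leaf-a leaf-b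

  two-spokes : 2 ≤ length ys → ∃[ w ] (w ∈ H × vS G H w ≡ 2 × + 2 ≤ℤ eS G H w)
  two-spokes 2≤ with two-distinct distinct 2≤
  ... | a , b , a∈ , b∈ , a≢b =
        pendant-path₃ (spoke∈H a∈) d∈H (spoke∈H b∈) (~-sym (proj₂ (spoke a∈))) (proj₂ (spoke b∈)) a≢b

  one-spoke : 1 ≤ length ys → ∃[ w ] (w ∈ H × vS G H w ≡ 2 × + 1 ≤ℤ eS G H w)
  one-spoke 1≤ with some-member 1≤
  ... | a , a∈ = pendant-edge (spoke∈H a∈) d∈H (~-sym (proj₂ (spoke a∈)))

lemma4 : {n : ℕ} (G : Graph n) → IsForest G →
    (i : ℕ) (H : Subset n) → Reachable G i H →
    (wS : Fin n) → Greedy G H wS →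
    (wD : Fin n) → wD ∈ remove G H wS →
    (l p : ℕ) →
    vD G (remove G H wS) wD ≡ 1 + l →
    eD G (remove G H wS) wD ≡ + (l + p) →
    ((l ≡ 2 × p ≡ 0 →
        Σ (Fin n) (λ w → w ∈ H ×
          ((vS G H w ≡ 2 × + 2 ≤ℤ eS G H w × + 1 ≤ℤ kS G H w)
           ⊎ (vS G H w ≡ 3 × + 4 ≤ℤ eS G H w × + 1 ≤ℤ kS G H w))))
    × (l ≡ 3 × p ≡ 0 →
        Σ (Fin n) (λ w → w ∈ H ×
          (vS G H w ≡ 2 × + 3 ≤ℤ eS G H w × + 1 ≤ℤ kS G H w)))
    × (l ≡ 3 × p ≡ 1 →
        Σ (Fin n) (λ w → w ∈ H ×
          ((vS G H w ≡ 2 × + 3 ≤ℤ eS G H w × + 1 ≤ℤ kS G H w)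
           ⊎ (vS G H w ≡ 3 × + 5 ≤ℤ eS G H w × + 1 ≤ℤ kS G H w))))
    × ((l ≡ 2 × p ≡ 1) ⊎ (3 ≤ l × l ≡ p × l ≤ 4) →
        Σ (Fin n) (λ w → w ∈ H ×
          (vS G H w ≡ 2 × + 2 ≤ℤ eS G H w)))
    × (l ≡ 1 × p ≡ 0 →
        Σ (Fin n) (λ w → w ∈ H ×
          (vS G H w ≡ 2 × + 1 ≤ℤ eS G H w)))
    × (l ≡ 0 × p ≡ 0 →
        Σ (Fin n) (λ w → w ∈ H ×
          ((vS G H w ≡ 2 × + 1 ≤ℤ eS G H w)
           ⊎ (vS G H w ≡ 1 × kS G H w ≡ -[1+ 0 ])))))
lemma4 {n} G forest _ H _ wS (wS∈H , _) d d∈S₁ l p vD≡ eD≡ =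
    (λ { (refl , refl) → tight-pair #ys≡l eD≡ (s≤s (s≤s z≤n)) })
  , (λ { (refl , refl) → tight-triple #ys≡l eD≡ ≤-refl })
  , (λ { (refl , refl) → loose-triple #ys≡l eD≡ ≤-refl })
  , (λ two≤ → two-spokes (subst (2 ≤_) (sym #ys≡l) (at-least-two two≤)))
  , (λ { (refl , refl) → one-spoke (≤-reflexive (sym #ys≡l)) })
  , (λ _ → pendant-or-isolated (remove⊆ d∈S₁))
  where
    open GraphFacts G
    open ForestFacts G forest
    ys : List (Fin n)
    ys = proj₁ (neighbours (remove G H wS) d)
    d-nbrs : Neighbours (remove G H wS) d ys
    d-nbrs = proj₂ (neighbours (remove G H wS) d)
    open Round G forest H wS∈H d∈S₁ d-nbrs
    #ys≡l : length ys ≡ l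
    #ys≡l = suc-injective (trans (sym (vS-Neighbours d∈S₁ d-nbrs)) vD≡)
    at-least-two : (l ≡ 2 × p ≡ 1) ⊎ (3 ≤ l × l ≡ p × l ≤ 4) → 2 ≤ l
    at-least-two (inj₁ (refl , _)) = s≤s (s≤s z≤n)
    at-least-two (inj₂ (3≤l , _))  = ≤-trans (s≤s (s≤s z≤n)) 3≤l
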